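{- For every $n\ge1$, every polyomino with $n$ tiles admits at most $\lceil n/2\rceil$ non-attacking rooks, and there exists a polyomino with $n$ tiles admitting $\lceil n/2\rceil$ non-attacking rooks. That is, the maximum number of non-attacking rooks that can be placed on a polyomino with $n$ tiles is $\lceil n/2\rceil$.
   Context: A polyomino is a finite union of unit squares (tiles) of the standard grid in $\mathbb{R}^2$ with connected interior. Two tiles of $P$ are in the same row (resp. column) of $P$ if the segment joining their centers is horizontal (resp. vertical) and contained in $P$. A set of rooks on distinct tiles is non-attacking if no two are in the same row or column of $P$. -}

module Defs where

open import Data.Nat using (ℕ)
open import Data.Integer using (ℤ; _+_; _≤_; 1ℤ)
open import Data.Product using (_×_; proj₁; proj₂; _,_; Σ)
open import Data.Sum using (_⊎_)
open import Data.List using (List; length)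
open import Data.List.Membership.Propositional using (_∈_)
open import Data.List.Relation.Unary.Unique.Propositional using (Unique)
open import Relation.Binary.PropositionalEquality using (_≡_; _≢_)
open import Relation.Nullary using (¬_)

-- A tile (unit square of the standard grid) is named by the integer
-- coordinates (x , y) of its lower-left corner: [x,x+1] × [y,y+1].
Tile : Set
Tile = ℤ × ℤ

Adjacent : Tile → Tile → Set
Adjacent (x , y) (x' , y') =
  (x ≡ x' × (y' ≡ y + 1ℤ ⊎ y ≡ y' + 1ℤ)) ⊎
  (y ≡ y' × (x' ≡ x + 1ℤ ⊎ x ≡ x' + 1ℤ))

data PathIn (P : List Tile) : Tile → Tile → Set where
  here : ∀ {a} → a ∈ P → PathIn P a a
  step : ∀ {a b c} → a ∈ P → Adjacent a b → PathIn P b c → PathIn P a c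

-- A finite union of tiles has connected interior iff its tiles are
-- connected through shared edges.
record Polyomino (P : List Tile) : Set where
  field
    distinct  : Unique P
    connected : ∀ {a b} → a ∈ P → b ∈ P → PathIn P a b

-- Same row: the horizontal segment joining the centres lies in P, i.e.
-- every tile of that row between them (inclusive) is a tile of P.
SameRow : List Tile → Tile → Tile → Set
SameRow P (x , y) (x' , y') =
  y ≡ y' × (∀ z → ((x ≤ z × z ≤ x') ⊎ (x' ≤ z × z ≤ x)) → (z , y) ∈ P)

SameColumn : List Tile → Tile → Tile → Set
SameColumn P (x , y) (x' , y') =
  x ≡ x' × (∀ z → ((y ≤ z × z ≤ y') ⊎ (y' ≤ z × z ≤ y)) → (x , z) ∈ P)

record NonAttacking (P : List Tile) (R : List Tile) : Set where
  field
    distinct : Unique R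
    onP      : ∀ {a} → a ∈ R → a ∈ P
    noRow    : ∀ {a b} → a ∈ R → b ∈ R → a ≢ b → ¬ SameRow P a b
    noColumn : ∀ {a b} → a ∈ R → b ∈ R → a ≢ b → ¬ SameColumn P a b

module Submission where

open import Defs
open import Data.Nat using (ℕ; _≤_; ⌈_/2⌉)
open import Data.List using (List; length)
open import Data.Product using (_×_; Σ)
open import Relation.Binary.PropositionalEquality using (_≡_)

open import Level using (0ℓ)
open import Function using (_∘_; id)
open import Data.Empty using (⊥-elim)
open import Data.Nat using (zero; suc; z≤n; s≤s; _+_; _≤?_)
open import Data.Nat.Properties
  using (≤-refl; ≤-trans; +-suc; +-comm; +-mono-≤; +-monoʳ-≤; +-monoˡ-≤; ⌊n/2⌋-mono; n≡⌊n+n/2⌋; module ≤-Reasoning)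
open import Data.Integer as ℤ using (ℤ; +_; 1ℤ)
import Data.Integer.Properties as ℤ
open import Data.Product using (_,_; proj₁; proj₂; ∃-syntax; Σ-syntax)
import Data.Product.Properties as Product
open import Data.Sum as Sum using (_⊎_; inj₁; inj₂)
open import Data.List using ([]; _∷_; [_]; _++_; map)
open import Data.List.Properties using (length-map; length-++)
open import Data.List.Membership.Propositional using (_∈_; _∉_)
open import Data.List.Membership.Propositional.Properties using (∈-map⁺; ∈-map⁻; ∈-++⁺ˡ; ∈-++⁺ʳ)
open import Data.List.Relation.Binary.Subset.Propositional using (_⊆_)
import Data.List.Relation.Binary.Subset.Propositional.Properties as Subset
open import Data.List.Relation.Unary.Any using (here; there)
open import Data.List.Relation.Unary.All as All using (All)
open import Data.List.Relation.Unary.AllPairs using ([]; _∷_)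
open import Data.List.Relation.Unary.Unique.Propositional using (Unique)
import Data.List.Relation.Unary.Unique.Propositional.Properties as Unique
open import Relation.Binary.Core using (Rel)
open import Relation.Binary.Definitions using (DecidableEquality; Transitive)
open import Relation.Binary.Structures using (IsPartialEquivalence)
open import Relation.Binary.PropositionalEquality using (_≢_; refl; sym; trans; cong; cong₂; subst)
open import Relation.Binary.Construct.Closure.ReflexiveTransitive as Star using (Star; ε; _◅_; _◅◅_)
open import Relation.Nullary using (¬_; Dec; yes; no)
open import Relation.Nullary.Decidable using (decidable-stable; ¬¬-excluded-middle)
open import Relation.Nullary.Negation using (¬¬-Monad)
open import Effect.Monad using (RawMonad)

-- Grow a connected set S of tiles one edge at a time, starting from a rook,
-- while recording the rooks W₁ in rows met by S and the rooks W₂ in columns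
-- met by S; initially S, W₁ and W₂ are that single rook.  A new tile shares
-- its row or its column with a tile already in S, and its other line holds at
-- most one rook, so |W₁| + |W₂| ≤ |S| + 1 is preserved.  Once S contains every
-- rook, R ⊆ W₁ and R ⊆ W₂, whence 2|R| ≤ |P| + 1.  All that is used of rows
-- and columns is that they are partial equivalences relating no two rooks.
-- The staircase (0,0), (1,0), (1,1), (2,1), (2,2), … with rooks on its
-- diagonal tiles attains ⌈n/2⌉.

private
  variable
    A : Set

∈-remove : {x : A} {ys : List A} → x ∈ ys →
  Σ[ zs ∈ List A ] length ys ≡ suc (length zs) × (∀ {y} → y ∈ ys → y ≢ x → y ∈ zs)
∈-remove {ys = _ ∷ ys} (here refl) = ys , refl , λ { (here refl) y≢x → ⊥-elim (y≢x refl) ; (there y∈) _ → y∈ }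
∈-remove {ys = w ∷ _} (there x∈) with zs , len , keep ← ∈-remove x∈ =
  w ∷ zs , cong suc len , λ { (here refl) _ → here refl ; (there y∈) y≢x → there (keep y∈ y≢x) }

Unique-⊆⇒length≤ : {xs ys : List A} → Unique xs → xs ⊆ ys → length xs ≤ length ys
Unique-⊆⇒length≤ {xs = []} _ _ = z≤n
Unique-⊆⇒length≤ {xs = x ∷ xs} {ys} (x∉xs ∷ xs!) xs⊆ys with zs , len , keep ← ∈-remove (xs⊆ys (here refl)) =
  subst (suc (length xs) ≤_) (sym len)
    (s≤s (Unique-⊆⇒length≤ xs! λ y∈xs → keep (xs⊆ys (there y∈xs)) (All.lookup x∉xs y∈xs ∘ sym)))

m+m≤1+n⇒m≤⌈n/2⌉ : ∀ m n → m + m ≤ suc n → m ≤ ⌈ n /2⌉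
m+m≤1+n⇒m≤⌈n/2⌉ m n m+m≤1+n = subst (_≤ ⌈ n /2⌉) (sym (n≡⌊n+n/2⌋ m)) (⌊n/2⌋-mono m+m≤1+n)

¬¬-All-Dec : {Q : A → Set} (xs : List A) → ¬ ¬ All (Dec ∘ Q) xs
¬¬-All-Dec xs = All.sequenceM 0ℓ ¬¬-Monad (All.universal (λ _ → ¬¬-excluded-middle) xs)

-- Counting rooks in a set connected by two partial equivalences

record PartialTransversal (_∼_ : Rel A 0ℓ) (R : List A) : Set where
  field
    isPartialEquivalence : IsPartialEquivalence _∼_
    reflexive-on         : ∀ {r} → r ∈ R → r ∼ r
    separates            : ∀ {r r′} → r ∈ R → r′ ∈ R → r ∼ r′ → r ≡ r′
  open IsPartialEquivalence isPartialEquivalence public renaming (sym to ∼-sym; trans to ∼-trans)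

Link : List A → Rel A 0ℓ → Rel A 0ℓ → Rel A 0ℓ
Link P _∼₁_ _∼₂_ a b = b ∈ P × (a ∼₁ b ⊎ a ∼₂ b)

module Covering (_≟_ : DecidableEquality A) (P R : List A) where

  open import Data.List.Membership.DecPropositional _≟_ using (_∈?_)
  open PartialTransversal

  Meets : Rel A 0ℓ → A → Set
  Meets _∼_ a = ∃[ r ] r ∈ R × a ∼ r

  class-members : ∀ {_∼_ b} → PartialTransversal _∼_ R → Dec (Meets _∼_ b) →
    Σ[ E ∈ List A ] length E ≤ 1 × (∀ {r} → r ∈ R → b ∼ r → r ∈ E)
  class-members t (yes (r₀ , r₀∈R , b∼r₀)) =
    [ r₀ ] , ≤-refl , λ r∈R b∼r → here (sym (separates t r₀∈R r∈R (∼-trans t (∼-sym t b∼r₀) b∼r)))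
  class-members t (no ¬meets) = [] , z≤n , λ r∈R b∼r → ⊥-elim (¬meets (_ , r∈R , b∼r))

  record Cover (_∼₁_ _∼₂_ : Rel A 0ℓ) : Set where
    field
      S W₁ W₂  : List A
      S⊆P      : S ⊆ P
      S-unique : Unique S
      size     : length W₁ + length W₂ ≤ suc (length S)
      covers₁  : ∀ {s r} → s ∈ S → r ∈ R → s ∼₁ r → r ∈ W₁
      covers₂  : ∀ {s r} → s ∈ S → r ∈ R → s ∼₂ r → r ∈ W₂
  open Cover

  swap : ∀ {_∼₁_ _∼₂_} → Cover _∼₁_ _∼₂_ → Cover _∼₂_ _∼₁_
  swap c = record
    { S = S c ; W₁ = W₂ c ; W₂ = W₁ c ; S⊆P = S⊆P c ; S-unique = S-unique c
    ; size = subst (_≤ suc (length (S c))) (+-comm (length (W₁ c)) (length (W₂ c))) (size c)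
    ; covers₁ = covers₂ c ; covers₂ = covers₁ c
    }

  GrowsTo : ∀ {_∼₁_ _∼₂_} → Cover _∼₁_ _∼₂_ → List A → Set
  GrowsTo {_∼₁_} {_∼₂_} c L = Σ[ c′ ∈ Cover _∼₁_ _∼₂_ ] S c ⊆ S c′ × L ⊆ S c′

  singleton : ∀ {_∼₁_ _∼₂_ r} → PartialTransversal _∼₁_ R → PartialTransversal _∼₂_ R →
    r ∈ R → r ∈ P → Cover _∼₁_ _∼₂_
  singleton {r = r} t₁ t₂ r∈R r∈P = record
    { S = [ r ] ; W₁ = [ r ] ; W₂ = [ r ]
    ; S⊆P = λ { (here refl) → r∈P }
    ; S-unique = All.[] ∷ []
    ; size = ≤-refl
    ; covers₁ = λ { (here refl) r′∈R r∼r′ → here (sym (separates t₁ r∈R r′∈R r∼r′)) }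
    ; covers₂ = λ { (here refl) r′∈R r∼r′ → here (sym (separates t₂ r∈R r′∈R r∼r′)) }
    }

  module _ {_∼₁_ _∼₂_ : Rel A 0ℓ} (∼₁-trans : Transitive _∼₁_) (t₂ : PartialTransversal _∼₂_ R)
           (meets₂? : ∀ {b} → b ∈ P → Dec (Meets _∼₂_ b)) where

    grow-along₁ : (c : Cover _∼₁_ _∼₂_) {a b : A} → a ∈ S c → b ∈ P → b ∉ S c → a ∼₁ b → GrowsTo c [ b ]
    grow-along₁ c {a} {b} a∈S b∈P b∉S a∼b with E , E≤1 , E-covers ← class-members t₂ (meets₂? b∈P) =
      record
        { S = b ∷ S c ; W₁ = W₁ c ; W₂ = E ++ W₂ c
        ; S⊆P = λ { (here refl) → b∈P ; (there s∈) → S⊆P c s∈ }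
        ; S-unique = All.tabulate (λ { s∈ refl → b∉S s∈ }) ∷ S-unique c
        ; size = size′
        ; covers₁ = λ { (here refl) r∈R b∼r → covers₁ c a∈S r∈R (∼₁-trans a∼b b∼r) ; (there s∈) → covers₁ c s∈ }
        ; covers₂ = λ { (here refl) r∈R b∼r → ∈-++⁺ˡ (E-covers r∈R b∼r)
                      ; (there s∈) r∈R s∼r → ∈-++⁺ʳ E (covers₂ c s∈ r∈R s∼r) }
        } , there , λ { (here refl) → here refl }
      where
      size′ : length (W₁ c) + length (E ++ W₂ c) ≤ suc (suc (length (S c)))
      size′ = begin
        length (W₁ c) + length (E ++ W₂ c)       ≡⟨ cong (λ k → length (W₁ c) + k) (length-++ E) ⟩
        length (W₁ c) + (length E + length (W₂ c)) ≤⟨ +-monoʳ-≤ (length (W₁ c)) (+-monoˡ-≤ (length (W₂ c)) E≤1) ⟩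
        length (W₁ c) + suc (length (W₂ c))      ≡⟨ +-suc (length (W₁ c)) (length (W₂ c)) ⟩
        suc (length (W₁ c) + length (W₂ c))      ≤⟨ s≤s (size c) ⟩
        suc (suc (length (S c)))                 ∎
        where open ≤-Reasoning

  module _ {_∼₁_ _∼₂_ : Rel A 0ℓ} (t₁ : PartialTransversal _∼₁_ R) (t₂ : PartialTransversal _∼₂_ R)
           (meets₁? : ∀ {b} → b ∈ P → Dec (Meets _∼₁_ b)) (meets₂? : ∀ {b} → b ∈ P → Dec (Meets _∼₂_ b)) where

    grow-link : (c : Cover _∼₁_ _∼₂_) {a b : A} → a ∈ S c → Link P _∼₁_ _∼₂_ a b → GrowsTo c [ b ]
    grow-link c {b = b} a∈S (b∈P , a∼b) with b ∈? S c
    ... | yes b∈S = c , id , λ { (here refl) → b∈S }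
    ... | no b∉S with a∼b
    ...   | inj₁ a∼₁b = grow-along₁ (∼-trans t₁) t₂ meets₂? c a∈S b∈P b∉S a∼₁b
    ...   | inj₂ a∼₂b with c′ , S⊆ , b∈ ← grow-along₁ (∼-trans t₂) t₁ meets₁? (swap c) a∈S b∈P b∉S a∼₂b =
      swap c′ , S⊆ , b∈

    grow-path : (c : Cover _∼₁_ _∼₂_) {a b : A} → a ∈ S c → Star (Link P _∼₁_ _∼₂_) a b → GrowsTo c [ b ]
    grow-path c a∈S ε = c , id , λ { (here refl) → a∈S }
    grow-path c a∈S (link ◅ links) with c₁ , S⊆₁ , b∈₁ ← grow-link c a∈S link
      with c₂ , S⊆₂ , d∈₂ ← grow-path c₁ (b∈₁ (here refl)) links =
      c₂ , S⊆₂ ∘ S⊆₁ , d∈₂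

    grow-all : (c : Cover _∼₁_ _∼₂_) {a : A} → a ∈ S c → (L : List A) →
      (∀ {b} → b ∈ L → Star (Link P _∼₁_ _∼₂_) a b) → GrowsTo c L
    grow-all c a∈S [] _ = c , id , λ ()
    grow-all c a∈S (b ∷ L) paths with c₁ , S⊆₁ , L⊆₁ ← grow-all c a∈S L (paths ∘ there)
      with c₂ , S⊆₂ , b∈₂ ← grow-path c₁ (S⊆₁ a∈S) (paths (here refl)) =
      c₂ , S⊆₂ ∘ S⊆₁ , λ { (here refl) → b∈₂ (here refl) ; (there b′∈) → S⊆₂ (L⊆₁ b′∈) }

    covering-bound : ∀ {r} → r ∈ R → Unique R → R ⊆ P → (∀ {b} → b ∈ R → Star (Link P _∼₁_ _∼₂_) r b) →
      length R + length R ≤ suc (length P)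
    covering-bound r∈R R! R⊆P paths
      with c , _ , R⊆S ← grow-all (singleton t₁ t₂ r∈R (R⊆P r∈R)) (here refl) R paths =
      ≤-trans (+-mono-≤ R≤W₁ R≤W₂) (≤-trans (size c) (s≤s (Unique-⊆⇒length≤ (S-unique c) (S⊆P c))))
      where
      R≤W₁ : length R ≤ length (W₁ c)
      R≤W₁ = Unique-⊆⇒length≤ R! λ r∈ → covers₁ c (R⊆S r∈) r∈ (reflexive-on t₁ r∈)
      R≤W₂ : length R ≤ length (W₂ c)
      R≤W₂ = Unique-⊆⇒length≤ R! λ r∈ → covers₂ c (R⊆S r∈) r∈ (reflexive-on t₂ r∈)

transversals⇒length≤ : (_≟_ : DecidableEquality A) {_∼₁_ _∼₂_ : Rel A 0ℓ} {P : List A} (R : List A) →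
  PartialTransversal _∼₁_ R → PartialTransversal _∼₂_ R → Unique R → R ⊆ P →
  (∀ {a b} → a ∈ R → b ∈ R → Star (Link P _∼₁_ _∼₂_) a b) → length R + length R ≤ suc (length P)
transversals⇒length≤ _≟_ [] _ _ _ _ _ = z≤n
-- The conclusion is decidable, so we may decide for every element of P whether
-- its ∼₁-class and its ∼₂-class contain a member of R.
transversals⇒length≤ _≟_ {_∼₁_} {_∼₂_} {P} R@(r ∷ _) t₁ t₂ R! R⊆P paths =
  decidable-stable (length R + length R ≤? suc (length P)) do
    meets₁? ← ¬¬-All-Dec {Q = Meets _∼₁_} P
    meets₂? ← ¬¬-All-Dec {Q = Meets _∼₂_} P
    pure (covering-bound t₁ t₂ (All.lookup meets₁?) (All.lookup meets₂?) (here refl) R! R⊆P (paths (here refl)))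
  where
  open Covering _≟_ P R
  open RawMonad ¬¬-Monad

-- Rows and columns of a polyomino

Between : ℤ → ℤ → ℤ → Set
Between x x′ z = (x ℤ.≤ z × z ℤ.≤ x′) ⊎ (x′ ℤ.≤ z × z ℤ.≤ x)

-- SameRow P (x , y) (x′ , y′) unfolds to y ≡ y′ × Segment (λ z → (z , y) ∈ P) x x′.
Segment : (ℤ → Set) → ℤ → ℤ → Set
Segment Q x x′ = ∀ z → Between x x′ z → Q z

between-sym : ∀ {x x′ z} → Between x x′ z → Between x′ x z
between-sym (inj₁ z∈) = inj₂ z∈
between-sym (inj₂ z∈) = inj₁ z∈

between-refl : ∀ {x z} → Between x x z → z ≡ x
between-refl (inj₁ (x≤z , z≤x)) = ℤ.≤-antisym z≤x x≤z
between-refl (inj₂ (x≤z , z≤x)) = ℤ.≤-antisym z≤x x≤z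

between-suc : ∀ {x z} → Between x (x ℤ.+ 1ℤ) z → z ≡ x ⊎ z ≡ x ℤ.+ 1ℤ
between-suc {x} {z} (inj₁ (x≤z , z≤x+1)) with x ℤ.≟ z
... | yes x≡z = inj₁ (sym x≡z)
... | no x≢z = inj₂ (ℤ.≤-antisym z≤x+1 (subst (ℤ._≤ z) (ℤ.+-comm 1ℤ x) (ℤ.i<j⇒suc[i]≤j (ℤ.≤∧≢⇒< x≤z x≢z))))
between-suc {x} (inj₂ (x+1≤z , z≤x)) =
  ⊥-elim (ℤ.<-irrefl refl (ℤ.suc[i]≤j⇒i<j (subst (ℤ._≤ x) (ℤ.+-comm x 1ℤ) (ℤ.≤-trans x+1≤z z≤x))))

segment-refl : ∀ {Q x} → Q x → Segment Q x x
segment-refl {Q} Qx z z∈ = subst Q (sym (between-refl z∈)) Qx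

segment-sym : ∀ {Q x x′} → Segment Q x x′ → Segment Q x′ x
segment-sym seg z z∈ = seg z (between-sym z∈)

segment-trans : ∀ {Q x x′ x″} → Segment Q x x′ → Segment Q x′ x″ → Segment Q x x″
segment-trans {x′ = x′} seg seg′ z (inj₁ (x≤z , z≤x″)) with ℤ.≤-total z x′
... | inj₁ z≤x′ = seg z (inj₁ (x≤z , z≤x′))
... | inj₂ x′≤z = seg′ z (inj₁ (x′≤z , z≤x″))
segment-trans {x′ = x′} seg seg′ z (inj₂ (x″≤z , z≤x)) with ℤ.≤-total z x′
... | inj₁ z≤x′ = seg′ z (inj₂ (x″≤z , z≤x′))
... | inj₂ x′≤z = seg z (inj₂ (x′≤z , z≤x))

segment-suc : ∀ {Q x} → Q x → Q (x ℤ.+ 1ℤ) → Segment Q x (x ℤ.+ 1ℤ)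
segment-suc Qx Qx+1 z z∈ with between-suc z∈
... | inj₁ refl = Qx
... | inj₂ refl = Qx+1

segment-adjacent : ∀ {Q x x′} → Q x → Q x′ → x′ ≡ x ℤ.+ 1ℤ ⊎ x ≡ x′ ℤ.+ 1ℤ → Segment Q x x′
segment-adjacent Qx Qx+1 (inj₁ refl) = segment-suc Qx Qx+1
segment-adjacent Qx+1 Qx (inj₂ refl) = segment-sym (segment-suc Qx Qx+1)

module _ {P : List Tile} where

  sameRow-isPartialEquivalence : IsPartialEquivalence (SameRow P)
  sameRow-isPartialEquivalence = record
    { sym = λ { {_ , _} {_ , _} (refl , seg) → refl , segment-sym seg }
    ; trans = λ { {_ , _} {_ , _} {_ , _} (refl , seg) (refl , seg′) → refl , segment-trans seg seg′ }
    }

  sameColumn-isPartialEquivalence : IsPartialEquivalence (SameColumn P)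
  sameColumn-isPartialEquivalence = record
    { sym = λ { {_ , _} {_ , _} (refl , seg) → refl , segment-sym seg }
    ; trans = λ { {_ , _} {_ , _} {_ , _} (refl , seg) (refl , seg′) → refl , segment-trans seg seg′ }
    }

  adjacent⇒sameRow⊎sameColumn : ∀ {a b} → a ∈ P → b ∈ P → Adjacent a b → SameRow P a b ⊎ SameColumn P a b
  adjacent⇒sameRow⊎sameColumn {_ , _} {_ , _} a∈P b∈P (inj₁ (refl , dy)) = inj₂ (refl , segment-adjacent a∈P b∈P dy)
  adjacent⇒sameRow⊎sameColumn {_ , _} {_ , _} a∈P b∈P (inj₂ (refl , dx)) = inj₁ (refl , segment-adjacent a∈P b∈P dx)

  pathIn-source∈ : ∀ {a b} → PathIn P a b → a ∈ P
  pathIn-source∈ (here a∈P) = a∈P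
  pathIn-source∈ (step a∈P _ _) = a∈P

  pathIn⇒links : ∀ {a b} → PathIn P a b → Star (Link P (SameRow P) (SameColumn P)) a b
  pathIn⇒links (here _) = ε
  pathIn⇒links (step a∈P adj path) =
    (b∈P , adjacent⇒sameRow⊎sameColumn a∈P b∈P adj) ◅ pathIn⇒links path
    where b∈P = pathIn-source∈ path

_≟ᵗ_ : DecidableEquality Tile
_≟ᵗ_ = Product.≡-dec ℤ._≟_ ℤ._≟_

module _ {P R : List Tile} (rooks : NonAttacking P R) where

  open NonAttacking rooks

  sameRow-transversal : PartialTransversal (SameRow P) R
  sameRow-transversal = record
    { isPartialEquivalence = sameRow-isPartialEquivalence
    ; reflexive-on = λ { {_ , _} r∈R → refl , segment-refl (onP r∈R) }
    ; separates = λ r∈R r′∈R row → decidable-stable (_ ≟ᵗ _) (λ r≢r′ → noRow r∈R r′∈R r≢r′ row)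
    }

  sameColumn-transversal : PartialTransversal (SameColumn P) R
  sameColumn-transversal = record
    { isPartialEquivalence = sameColumn-isPartialEquivalence
    ; reflexive-on = λ { {_ , _} r∈R → refl , segment-refl (onP r∈R) }
    ; separates = λ r∈R r′∈R column → decidable-stable (_ ≟ᵗ _) (λ r≢r′ → noColumn r∈R r′∈R r≢r′ column)
    }

  nonAttacking⇒length≤ : Polyomino P → length R + length R ≤ suc (length P)
  nonAttacking⇒length≤ polyomino =
    transversals⇒length≤ _≟ᵗ_ R sameRow-transversal sameColumn-transversal distinct onP
      (λ a∈R b∈R → pathIn⇒links (connected (onP a∈R) (onP b∈R)))
    where open Polyomino polyomino using (connected)

-- The staircase

Point : Set
Point = ℕ × ℕ

toTile : Point → Tile
toTile (x , y) = + x , + y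

shift : Point → Point
shift (x , y) = suc x , suc y

data Move : Point → Point → Set where
  right : ∀ {x y} → Move (x , y) (suc x , y)
  up    : ∀ {x y} → Move (x , y) (x , suc y)

Edge : List Point → Rel Point 0ℓ
Edge S a b = a ∈ S × b ∈ S × (Move a b ⊎ Move b a)

shift-move : ∀ {a b} → Move a b → Move (shift a) (shift b)
shift-move right = right
shift-move up = up

edge-sym : ∀ {S a b} → Edge S a b → Edge S b a
edge-sym (a∈ , b∈ , inj₁ move) = b∈ , a∈ , inj₂ move
edge-sym (a∈ , b∈ , inj₂ move) = b∈ , a∈ , inj₁ move

edge-mono : ∀ {S S′ a b} → S ⊆ S′ → Edge S a b → Edge S′ a b
edge-mono S⊆S′ (a∈ , b∈ , move) = S⊆S′ a∈ , S⊆S′ b∈ , move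

shift-edge : ∀ {S a b} → Edge S a b → Edge (map shift S) (shift a) (shift b)
shift-edge (a∈ , b∈ , move) = ∈-map⁺ shift a∈ , ∈-map⁺ shift b∈ , Sum.map shift-move shift-move move

staircase : ℕ → List Point
staircase zero = []
staircase (suc zero) = [ (0 , 0) ]
staircase (suc (suc n)) = (0 , 0) ∷ (1 , 0) ∷ map shift (staircase n)

diagonal : ℕ → List Point
diagonal zero = []
diagonal (suc zero) = [ (0 , 0) ]
diagonal (suc (suc n)) = (0 , 0) ∷ map shift (diagonal n)

length-staircase : ∀ n → length (staircase n) ≡ n
length-staircase zero = refl
length-staircase (suc zero) = refl
length-staircase (suc (suc n)) = cong (suc ∘ suc) (trans (length-map shift (staircase n)) (length-staircase n))

length-diagonal : ∀ n → length (diagonal n) ≡ ⌈ n /2⌉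
length-diagonal zero = refl
length-diagonal (suc zero) = refl
length-diagonal (suc (suc n)) = cong suc (trans (length-map shift (diagonal n)) (length-diagonal n))

toTile-injective : ∀ {a b} → toTile a ≡ toTile b → a ≡ b
toTile-injective eq = cong₂ _,_ (ℤ.+-injective (cong proj₁ eq)) (ℤ.+-injective (cong proj₂ eq))

shift-injective : ∀ {a b} → shift a ≡ shift b → a ≡ b
shift-injective refl = refl

shift-off-axis : ∀ {x} p → (x , 0) ≢ shift p
shift-off-axis _ ()

axis∉shift : ∀ {x S} → All ((x , 0) ≢_) (map shift S)
axis∉shift = All.tabulate λ a∈ x0≡a →
  let p , _ , a≡p′ = ∈-map⁻ shift a∈ in shift-off-axis p (trans x0≡a a≡p′)

staircase-unique : ∀ n → Unique (staircase n)
staircase-unique zero = []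
staircase-unique (suc zero) = All.[] ∷ []
staircase-unique (suc (suc n)) = ((λ ()) All.∷ axis∉shift) ∷ axis∉shift ∷ Unique.map⁺ shift-injective (staircase-unique n)

diagonal-unique : ∀ n → Unique (diagonal n)
diagonal-unique zero = []
diagonal-unique (suc zero) = All.[] ∷ []
diagonal-unique (suc (suc n)) = axis∉shift ∷ Unique.map⁺ shift-injective (diagonal-unique n)

diagonal⊆staircase : ∀ n → diagonal n ⊆ staircase n
diagonal⊆staircase (suc zero) r∈ = r∈
diagonal⊆staircase (suc (suc n)) (here refl) = here refl
diagonal⊆staircase (suc (suc n)) (there r∈) = there (there (Subset.map⁺ shift (diagonal⊆staircase n) r∈))

∈diagonal⇒x≡y : ∀ n {r} → r ∈ diagonal n → proj₁ r ≡ proj₂ r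
∈diagonal⇒x≡y (suc zero) (here refl) = refl
∈diagonal⇒x≡y (suc (suc n)) (here refl) = refl
∈diagonal⇒x≡y (suc (suc n)) (there r∈) with _ , p∈ , refl ← ∈-map⁻ shift r∈ =
  cong suc (∈diagonal⇒x≡y n p∈)

origin∈staircase : ∀ n {a} → a ∈ staircase n → (0 , 0) ∈ staircase n
origin∈staircase (suc zero) _ = here refl
origin∈staircase (suc (suc n)) _ = here refl

origin-reaches : ∀ n {a} → a ∈ staircase n → Star (Edge (staircase n)) (0 , 0) a
origin-reaches (suc zero) (here refl) = ε
origin-reaches (suc (suc n)) (here refl) = ε
origin-reaches (suc (suc n)) (there (here refl)) = (here refl , there (here refl) , inj₁ right) ◅ ε
origin-reaches (suc (suc n)) (there (there a∈)) with p , p∈ , refl ← ∈-map⁻ shift a∈ =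
  (here refl , there (here refl) , inj₁ right)
  ◅ (there (here refl) , there (there (∈-map⁺ shift (origin∈staircase n p∈))) , inj₁ up)
  ◅ Star.map (edge-mono (there ∘ there)) (Star.gmap shift shift-edge (origin-reaches n p∈))

+[1+n]≡+n+1 : ∀ n → + suc n ≡ + n ℤ.+ 1ℤ
+[1+n]≡+n+1 n = cong +_ (+-comm 1 n)

move⇒adjacent : ∀ {a b} → Move a b ⊎ Move b a → Adjacent (toTile a) (toTile b)
move⇒adjacent (inj₁ (right {x})) = inj₂ (refl , inj₁ (+[1+n]≡+n+1 x))
move⇒adjacent (inj₁ (up {y = y})) = inj₁ (refl , inj₁ (+[1+n]≡+n+1 y))
move⇒adjacent (inj₂ (right {x})) = inj₂ (refl , inj₂ (+[1+n]≡+n+1 x))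
move⇒adjacent (inj₂ (up {y = y})) = inj₁ (refl , inj₂ (+[1+n]≡+n+1 y))

edges⇒pathIn : ∀ {S a b} → a ∈ S → Star (Edge S) a b → PathIn (map toTile S) (toTile a) (toTile b)
edges⇒pathIn a∈ ε = here (∈-map⁺ toTile a∈)
edges⇒pathIn _ ((a∈ , b∈ , move) ◅ edges) = step (∈-map⁺ toTile a∈) (move⇒adjacent move) (edges⇒pathIn b∈ edges)

staircase-polyomino : ∀ n → Polyomino (map toTile (staircase n))
staircase-polyomino n = record
  { distinct = Unique.map⁺ toTile-injective (staircase-unique n)
  ; connected = connected
  }
  where
  connected : ∀ {a b} → a ∈ map toTile (staircase n) → b ∈ map toTile (staircase n) →
    PathIn (map toTile (staircase n)) a b
  connected a∈ b∈ with a′ , a′∈ , refl ← ∈-map⁻ toTile a∈ | b′ , b′∈ , refl ← ∈-map⁻ toTile b∈ =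
    edges⇒pathIn a′∈ (Star.reverse edge-sym (origin-reaches n a′∈) ◅◅ origin-reaches n b′∈)

diagonal-nonAttacking : ∀ n → NonAttacking (map toTile (staircase n)) (map toTile (diagonal n))
diagonal-nonAttacking n = record
  { distinct = Unique.map⁺ toTile-injective (diagonal-unique n)
  ; onP = Subset.map⁺ toTile (diagonal⊆staircase n)
  ; noRow = λ { {_ , _} {_ , _} a∈ b∈ a≢b (y≡y′ , _) → a≢b (aligned⇒≡ a∈ b∈ (inj₂ y≡y′)) }
  ; noColumn = λ { {_ , _} {_ , _} a∈ b∈ a≢b (x≡x′ , _) → a≢b (aligned⇒≡ a∈ b∈ (inj₁ x≡x′)) }
  }
  where
  aligned⇒≡ : ∀ {a b} → a ∈ map toTile (diagonal n) → b ∈ map toTile (diagonal n) →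
    proj₁ a ≡ proj₁ b ⊎ proj₂ a ≡ proj₂ b → a ≡ b
  aligned⇒≡ a∈ b∈ aligned with a′ , a′∈ , refl ← ∈-map⁻ toTile a∈ | b′ , b′∈ , refl ← ∈-map⁻ toTile b∈
    with refl ← ∈diagonal⇒x≡y n a′∈ | refl ← ∈diagonal⇒x≡y n b′∈ | aligned
  ... | inj₁ x≡x′ = cong (λ k → + k , + k) (ℤ.+-injective x≡x′)
  ... | inj₂ x≡x′ = cong (λ k → + k , + k) (ℤ.+-injective x≡x′)

theorem18 : (n : ℕ) → 1 ≤ n →
    ((P : List Tile) → Polyomino P → length P ≡ n →
      (R : List Tile) → NonAttacking P R → length R ≤ ⌈ n /2⌉)
    × Σ (List Tile) (λ P → Polyomino P × length P ≡ n ×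
        Σ (List Tile) (λ R → NonAttacking P R × length R ≡ ⌈ n /2⌉))
theorem18 n _ = upper-bound , staircase-attains
  where
  upper-bound : (P : List Tile) → Polyomino P → length P ≡ n →
    (R : List Tile) → NonAttacking P R → length R ≤ ⌈ n /2⌉
  upper-bound P polyomino refl R rooks =
    m+m≤1+n⇒m≤⌈n/2⌉ (length R) (length P) (nonAttacking⇒length≤ rooks polyomino)

  staircase-attains : Σ (List Tile) (λ P → Polyomino P × length P ≡ n ×
    Σ (List Tile) (λ R → NonAttacking P R × length R ≡ ⌈ n /2⌉))
  staircase-attains =
    map toTile (staircase n) , staircase-polyomino n ,
    trans (length-map toTile (staircase n)) (length-staircase n) ,
    map toTile (diagonal n) , diagonal-nonAttacking n ,
    trans (length-map toTile (diagonal n)) (length-diagonal n)
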